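{- Let $NC$ be an initial neuronal circuit satisfying $\mathit{PositiveLoop}(NC)$, with neurons $N_0,N_1$ (identifiers $0,1$). Assume $w_{N_0}(2)\ge\tau_{N_0}$, $w_{N_0}(1)\ge\tau_{N_0}$ and $w_{N_1}(0)\ge\tau_{N_1}$. Let $\mathit{inp}_1,\mathit{inp}_2$ be lists of booleans all of whose entries are $0$. Then $$output_{NC}(N_0,\mathit{inp}_1\mathbin{++}[1]\mathbin{++}\mathit{inp}_2)=\mathit{repeat\_pattern}([1;0],|\mathit{inp}_1|+1)\mathbin{++}\mathit{repeat}(0,|\mathit{inp}_2|+1)$$ and $$output_{NC}(N_1,\mathit{inp}_1\mathbin{++}[1]\mathbin{++}\mathit{inp}_2)=\mathit{repeat\_pattern}([1;0],|\mathit{inp}_1|)\mathbin{++}\mathit{repeat}(0,|\mathit{inp}_2|+2).$$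
   Context: Booleans are identified with $0$ (false) and $1$ (true). A neuron $N$ consists of an identifier $id_N\in\mathbb{N}$, a weight function $w_N:\mathbb{N}\to\mathbb{Q}$ with $-1\le w_N(x)\le 1$ for all $x$ and $w_N(id_N)=0$, a leak factor $lk_N\in\mathbb{Q}$ with $0\le lk_N\le 1$, a threshold $\tau_N\in\mathbb{Q}$ with $\tau_N>0$, an output list $Output(N)$ of booleans (most recent first) and a current potential $CurPot(N)\in\mathbb{Q}$, subject to: $(\tau_N\le CurPot(N))$ equals the head of $Output(N)$ (the head of an empty list being $0$). An input function is a map $i:\mathbb{N}\to\{0,1\}$; $potential(w,i,len)=\sum_{0\le k<len,\ i(k)=1} w(k)$. The one-step update of $N$ with input function $i$ in an environment of $len$ neurons keeps $id,w,lk,\tau$, sets the new potential $p=potential(w_N,i,len)$ if $\tau_N\le CurPot(N)$ and $p=potential(w_N,i,len)+lk_N\cdot CurPot(N)$ otherwise, and sets the new output list to $(\tau_N\le p)::Output(N)$. A neuron is initial if its output list is $[0]$ and its current potential is $0$. A neuronal circuit $NC$ consists of a time $t_{NC}$, a list $ln_{NC}$ of neurons with pairwise distinct identifiers all $<|ln_{NC}|$ and all output lists of length $t_{NC}+1$, and a number $si_{NC}$ of external sources, with identifiers $|ln_{NC}|,\dots,L-1$, $L=|ln_{NC}|+si_{NC}$. One step of $NC$ on an external input function $e$ replaces each neuron $N$ by its one-step update in an environment of $L$ neurons with input function $x\mapsto$ (head of the output list, before the step, of the circuit neuron with identifier $x$ if $x<|ln_{NC}|$; $e(x)$ otherwise),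 and increments the time. A list of external inputs (most recent first) is processed from its last element to its first. $output_{NC}(N,\mathit{inp})$ is the output list of the neuron with identifier $id_N$ after processing $\mathit{inp}$. $NC$ is initial if all its neurons are initial. When $si_{NC}=1$, an external input sequence is a list of booleans, each giving the value supplied by the unique external source at that step. $\mathit{PositiveLoop}(NC)$ means: $si_{NC}=1$, $|ln_{NC}|=2$, the neuron with identifier $0$ has $w(1)>0$ and $w(2)>0$, and the neuron with identifier $1$ has $w(0)>0$ and $w(2)=0$ (the external source has identifier $2$). $\mathbin{++}$ is concatenation; $\mathit{repeat}(v,k)$ is the list of $k$ copies of $v$; for a nonempty list $l=[l_0;\dots;l_{r-1}]$, $\mathit{repeat\_pattern}(l,k)=[x_{k-1};\dots;x_1;x_0]$ with $x_j=l_{j\bmod r}$ (e.g. $\mathit{repeat\_pattern}([1;0],3)=[1;0;1]$, $\mathit{repeat\_pattern}([1;0],4)=[0;1;0;1]$). -}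

module Defs where

open import Data.Bool using (Bool; true; false; if_then_else_)
open import Data.Nat as ℕ using (ℕ; zero; suc; _%_)
open import Data.Nat.DivMod using (m%n<n)
open import Data.Rational as ℚ using (ℚ; 0ℚ; 1ℚ; -_; _+_; _*_; _≤_; _<_; _≤ᵇ_)
open import Data.List using (List; []; _∷_; length; map; lookup; foldr)
open import Data.List.Properties using (length-map)
open import Data.List.Relation.Unary.All.Properties using (map⁺)
open import Data.List.Relation.Unary.All as All using (All)
open import Data.List.Relation.Unary.Unique.Propositional using (Unique)
open import Data.Fin using (fromℕ<)
open import Data.Maybe using (Maybe; just; nothing)
open import Data.Product using (_×_)
open import Data.List.Membership.Propositional using (_∈_)
open import Relation.Binary.PropositionalEquality using (_≡_; refl; sym; subst; cong)
open import Relation.Nullary using (yes; no)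

headB : List Bool → Bool
headB []      = false
headB (b ∷ _) = b

record Neuron : Set where
  field
    ident   : ℕ
    w       : ℕ → ℚ
    lk      : ℚ
    τ       : ℚ
    output  : List Bool          -- most recent first
    curPot  : ℚ
    w-lo    : ∀ x → - 1ℚ ≤ w x
    w-hi    : ∀ x → w x ≤ 1ℚ
    w-self  : w ident ≡ 0ℚ
    lk-lo   : 0ℚ ≤ lk
    lk-hi   : lk ≤ 1ℚ
    τ-pos   : 0ℚ < τ
    consistent : (τ ≤ᵇ curPot) ≡ headB output

open Neuron public

potential : (ℕ → ℚ) → (ℕ → Bool) → ℕ → ℚ
potential w i zero    = 0ℚ
potential w i (suc k) = potential w i k + (if i k then w k else 0ℚ)

updateNeuron : (ℕ → Bool) → ℕ → Neuron → Neuron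
updateNeuron i len N = record
  { ident = ident N ; w = w N ; lk = lk N ; τ = τ N
  ; output = (τ N ≤ᵇ p) ∷ output N
  ; curPot = p
  ; w-lo = w-lo N ; w-hi = w-hi N ; w-self = w-self N
  ; lk-lo = lk-lo N ; lk-hi = lk-hi N ; τ-pos = τ-pos N
  ; consistent = refl }
  where
  p : ℚ
  p = if τ N ≤ᵇ curPot N
        then potential (w N) i len
        else potential (w N) i len + lk N * curPot N

InitialNeuron : Neuron → Set
InitialNeuron N = (output N ≡ false ∷ []) × (curPot N ≡ 0ℚ)

record Circuit : Set where
  field
    time    : ℕ
    ln      : List Neuron
    si      : ℕ
    ids-distinct : Unique (map ident ln)
    ids-bound    : All (λ N → ident N ℕ.< length ln) ln
    out-length   : All (λ N → length (output N) ≡ suc time) ln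

open Circuit public

findNeuron : List Neuron → ℕ → Maybe Neuron
findNeuron []       x = nothing
findNeuron (N ∷ ns) x with ident N ℕ.≟ x
... | yes _ = just N
... | no  _ = findNeuron ns x

headOutputOf : List Neuron → ℕ → Bool
headOutputOf ns x with findNeuron ns x
... | just N  = headB (output N)
... | nothing = false

circuitInput : List Neuron → (ℕ → Bool) → ℕ → Bool
circuitInput ns e x = if x ℕ.<ᵇ length ns then headOutputOf ns x else e x

private
  map-ident-upd : ∀ i len (ns : List Neuron) → map ident (map (updateNeuron i len) ns) ≡ map ident ns
  map-ident-upd i len []       = refl
  map-ident-upd i len (N ∷ ns) rewrite map-ident-upd i len ns = refl

step : (ℕ → Bool) → Circuit → Circuit
step e NC = record
  { time = suc (time NC)
  ; ln   = ln'
  ; si   = si NC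
  ; ids-distinct = subst Unique (sym (map-ident-upd i L (ln NC))) (ids-distinct NC)
  ; ids-bound = map⁺ (All.map (subst (λ m → _ ℕ.< m) (sym (length-map (updateNeuron i L) (ln NC))))
                                  (ids-bound NC))
  ; out-length = map⁺ (All.map (cong suc) (out-length NC))
  }
  where
  L : ℕ
  L = length (ln NC) ℕ.+ si NC
  i : ℕ → Bool
  i = circuitInput (ln NC) e
  ln' : List Neuron
  ln' = map (updateNeuron i L) (ln NC)

-- processing a list of external inputs (most recent first): from its last element to its first
process : Circuit → List (ℕ → Bool) → Circuit
process NC []         = NC
process NC (e ∷ inp)  = step e (process NC inp)

-- with a single external source, a boolean b is the external input function giving b
-- (only its value at the source identifier |ln| matters)
fromBool : Bool → (ℕ → Bool)
fromBool b _ = b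

outputNC : Circuit → Neuron → List (ℕ → Bool) → Maybe (List Bool)
outputNC NC N inp with findNeuron (ln (process NC inp)) (ident N)
... | just N' = just (output N')
... | nothing = nothing

InitialCircuit : Circuit → Set
InitialCircuit NC = All InitialNeuron (ln NC)

PositiveLoop : Circuit → Set
PositiveLoop NC =
  (si NC ≡ 1) × (length (ln NC) ≡ 2)
  × (∀ N → N ∈ ln NC → ident N ≡ 0 → (0ℚ < w N 1) × (0ℚ < w N 2))
  × (∀ N → N ∈ ln NC → ident N ≡ 1 → (0ℚ < w N 0) × (w N 2 ≡ 0ℚ))

-- repeat(v,k) is the library's  replicate k v  (Data.List)

repeatPattern : {A : Set} → (l : List A) → .{{ _ : ℕ.NonZero (length l) }} → ℕ → List A
repeatPattern l zero    = []
repeatPattern l (suc k) = lookup l (fromℕ< (m%n<n k (length l))) ∷ repeatPattern l k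

-- Under the threshold hypotheses each neuron is an OR gate: every input it listens to reaches the
-- threshold on its own and all other weights are 0, so it fires exactly when one of those inputs is
-- active, and when it stays silent its potential is 0, which makes the leak irrelevant. N₀ listens
-- to N₁ and the source, N₁ to N₀, so the outputs follow o₀′ = o₁ ∨ e, o₁′ = o₀. With silent input
-- this recurrence swaps the two heads, so the single pulse circulates around the loop and both
-- neurons alternate.
module Submission where

open import Defs
open import Data.Bool using (Bool; true; false; _∨_; if_then_else_)
open import Data.Bool.Properties using (T-≡; ∨-identityʳ)
open import Data.Empty using (⊥-elim)
open import Data.Nat as ℕ using (ℕ; zero; suc; _+_; _<_; _<ᵇ_; s≤s; z≤n)
open import Data.Nat.Properties using (n<1+n; m<n⇒m<1+n; <⇒<ᵇ; <ᵇ⇒<; ≤⇒≯; +-comm)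
open import Data.Rational using (ℚ; 0ℚ; _≤_; _≤ᵇ_) renaming (_+_ to _+ℚ_; _<_ to _<ℚ_)
open import Data.Rational.Properties
  using (≤-refl; ≤-reflexive; ≤-trans; <⇒≤; <-≤-trans; <-irrefl; +-mono-≤; +-identityˡ; +-identityʳ; *-zeroʳ; ≤⇒≤ᵇ; ≤ᵇ⇒≤)
open import Data.List using (List; []; _∷_; _++_; length; map; replicate; foldr)
open import Data.List.Properties using (length-map; foldr-++)
open import Data.List.Membership.Propositional using (_∈_)
open import Data.List.Membership.Propositional.Properties using (∈-map⁺)
open import Data.List.Relation.Unary.All as All using (All; []; _∷_)
open import Data.List.Relation.Unary.AllPairs using (_∷_)
open import Data.List.Relation.Unary.Any using (here; there)
open import Data.List.Relation.Unary.Unique.Propositional using (Unique)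
open import Data.Maybe as Maybe using (just)
open import Data.Product using (_×_; _,_; proj₁; proj₂)
open import Function using (_∘_)
open import Function.Bundles using (Equivalence)
open import Relation.Nullary using (yes; no)
open import Relation.Binary.PropositionalEquality using (_≡_; refl; sym; trans; cong; cong₂; subst)

≤⇒≤ᵇ≡true : ∀ {p q} → p ≤ q → (p ≤ᵇ q) ≡ true
≤⇒≤ᵇ≡true = Equivalence.to T-≡ ∘ ≤⇒≤ᵇ

>⇒≤ᵇ≡false : ∀ {p q} → q <ℚ p → (p ≤ᵇ q) ≡ false
>⇒≤ᵇ≡false {p} {q} q<p with p ≤ᵇ q in p≤ᵇq
... | false = refl
... | true  = ⊥-elim (<-irrefl refl (<-≤-trans q<p (≤ᵇ⇒≤ (Equivalence.from T-≡ p≤ᵇq))))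

p≤q⇒p≤q+r : ∀ {p q r} → p ≤ q → 0ℚ ≤ r → p ≤ q +ℚ r
p≤q⇒p≤q+r {p} p≤q 0≤r = subst (_≤ _) (+-identityʳ p) (+-mono-≤ p≤q 0≤r)

p≤r⇒p≤q+r : ∀ {p q r} → 0ℚ ≤ q → p ≤ r → p ≤ q +ℚ r
p≤r⇒p≤q+r {p} 0≤q p≤r = subst (_≤ _) (+-identityˡ p) (+-mono-≤ 0≤q p≤r)

if-nonNeg : ∀ b {q} → 0ℚ ≤ q → 0ℚ ≤ (if b then q else 0ℚ)
if-nonNeg true  0≤q = 0≤q
if-nonNeg false _   = ≤-refl

potential-nonNeg : ∀ (w : ℕ → ℚ) i len → (∀ {k} → k < len → 0ℚ ≤ w k) → 0ℚ ≤ potential w i len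
potential-nonNeg w i zero      _   = ≤-refl
potential-nonNeg w i (suc len) w≥0 =
  p≤r⇒p≤q+r (potential-nonNeg w i len (w≥0 ∘ m<n⇒m<1+n)) (if-nonNeg (i len) (w≥0 (n<1+n len)))

RestsWhenSilent : Neuron → Set
RestsWhenSilent N = headB (output N) ≡ false → curPot N ≡ 0ℚ

curPot-updateNeuron : ∀ i len N → RestsWhenSilent N → curPot (updateNeuron i len N) ≡ potential (w N) i len
curPot-updateNeuron i len N rests with τ N ≤ᵇ curPot N in fired
... | true  = refl
... | false rewrite rests (trans (sym (consistent N)) fired) | *-zeroʳ (lk N) = +-identityʳ _

anyActive : (ℕ → Bool) → (ℕ → Bool) → ℕ → Bool
anyActive S i zero      = false
anyActive S i (suc len) = if S len then anyActive S i len ∨ i len else anyActive S i len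

record IsOrGate (S : ℕ → Bool) (len : ℕ) (N : Neuron) : Set where
  field
    excitatory : ∀ {k} → k < len → S k ≡ true → τ N ≤ w N k
    mute       : ∀ {k} → k < len → S k ≡ false → w N k ≡ 0ℚ

module _ {S : ℕ → Bool} {N : Neuron} where
  open IsOrGate

  IsOrGate-pred : ∀ {len} → IsOrGate S (suc len) N → IsOrGate S len N
  IsOrGate-pred g = record { excitatory = excitatory g ∘ m<n⇒m<1+n ; mute = mute g ∘ m<n⇒m<1+n }

  IsOrGate-updateNeuron : ∀ {len} i len′ → IsOrGate S len N → IsOrGate S len (updateNeuron i len′ N)
  IsOrGate-updateNeuron _ _ g = record { excitatory = excitatory g ; mute = mute g }

  IsOrGate⇒nonNeg : ∀ {len} → IsOrGate S len N → ∀ {k} → k < len → 0ℚ ≤ w N k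
  IsOrGate⇒nonNeg g {k} k<len with S k in Sk
  ... | true  = ≤-trans (<⇒≤ (τ-pos N)) (excitatory g k<len Sk)
  ... | false = ≤-reflexive (sym (mute g k<len Sk))

  IsOrGate⇒potential≡0 : ∀ i len → IsOrGate S len N → anyActive S i len ≡ false → potential (w N) i len ≡ 0ℚ
  IsOrGate⇒potential≡0 i zero      g _ = refl
  IsOrGate⇒potential≡0 i (suc len) g silent with S len in Sk | anyActive S i len in before | i len
  ... | false | false | true  rewrite IsOrGate⇒potential≡0 i len (IsOrGate-pred g) before
                                    | mute g (n<1+n len) Sk = refl
  ... | false | false | false rewrite IsOrGate⇒potential≡0 i len (IsOrGate-pred g) before = refl
  ... | true  | false | false rewrite IsOrGate⇒potential≡0 i len (IsOrGate-pred g) before = refl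

  IsOrGate⇒τ≤potential : ∀ i len → IsOrGate S len N → anyActive S i len ≡ true → τ N ≤ potential (w N) i len
  IsOrGate⇒τ≤potential i (suc len) g fires with S len in Sk | anyActive S i len in before | i len
  ... | _    | true  | _ = p≤q⇒p≤q+r (IsOrGate⇒τ≤potential i len (IsOrGate-pred g) before)
                                       (if-nonNeg _ (IsOrGate⇒nonNeg g (n<1+n len)))
  ... | true | false | true = p≤r⇒p≤q+r (potential-nonNeg (w N) i len (IsOrGate⇒nonNeg (IsOrGate-pred g)))
                                          (excitatory g (n<1+n len) Sk)

  IsOrGate⇒fires : ∀ i len → IsOrGate S len N → (τ N ≤ᵇ potential (w N) i len) ≡ anyActive S i len
  IsOrGate⇒fires i len g with anyActive S i len in fires
  ... | true  = ≤⇒≤ᵇ≡true (IsOrGate⇒τ≤potential i len g fires)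
  ... | false rewrite IsOrGate⇒potential≡0 i len g fires = >⇒≤ᵇ≡false (τ-pos N)

  updateNeuron-IsOrGate : ∀ i len → IsOrGate S len N → RestsWhenSilent N →
    output (updateNeuron i len N) ≡ anyActive S i len ∷ output N × RestsWhenSilent (updateNeuron i len N)
  updateNeuron-IsOrGate i len g rests = cong (_∷ output N) fires , λ silent →
    trans curPot≡ (IsOrGate⇒potential≡0 i len g (trans (sym fires) silent))
    where
    curPot≡ : curPot (updateNeuron i len N) ≡ potential (w N) i len
    curPot≡ = curPot-updateNeuron i len N rests
    fires : (τ N ≤ᵇ curPot (updateNeuron i len N)) ≡ anyActive S i len
    fires = trans (cong (τ N ≤ᵇ_) curPot≡) (IsOrGate⇒fires i len g)

findNeuron-map-updateNeuron : ∀ i len ns x →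
  findNeuron (map (updateNeuron i len) ns) x ≡ Maybe.map (updateNeuron i len) (findNeuron ns x)
findNeuron-map-updateNeuron i len []       x = refl
findNeuron-map-updateNeuron i len (N ∷ ns) x with ident N ℕ.≟ x
... | yes _ = refl
... | no  _ = findNeuron-map-updateNeuron i len ns x

findNeuron-unique : ∀ {ns N} → Unique (map ident ns) → N ∈ ns → findNeuron ns (ident N) ≡ just N
findNeuron-unique {M ∷ _} _ (here refl) with ident M ℕ.≟ ident M
... | yes _  = refl
... | no  M≢ = ⊥-elim (M≢ refl)
findNeuron-unique {M ∷ _} {N} (M≢ns ∷ unique) (there N∈ns) with ident M ℕ.≟ ident N
... | yes M≡N = ⊥-elim (All.lookup M≢ns (∈-map⁺ ident N∈ns) M≡N)
... | no  _   = findNeuron-unique unique N∈ns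

circuitInput-neuron : ∀ ns e {x N} → findNeuron ns x ≡ just N → x < length ns →
  circuitInput ns e x ≡ headB (output N)
circuitInput-neuron ns e {x} found x<ns
  rewrite Equivalence.to T-≡ (<⇒<ᵇ x<ns) | found = refl

circuitInput-source : ∀ ns e {x} → length ns ℕ.≤ x → circuitInput ns e x ≡ e x
circuitInput-source ns e {x} ns≤x with x <ᵇ length ns in x<ᵇns
... | false = refl
... | true  = ⊥-elim (≤⇒≯ ns≤x (<ᵇ⇒< x (length ns) (Equivalence.from T-≡ x<ᵇns)))

record OrGateAt (S : ℕ → Bool) (len : ℕ) (NC : Circuit) (x : ℕ) (o : List Bool) : Set where
  field
    neuron   : Neuron
    found    : findNeuron (ln NC) x ≡ just neuron
    isOrGate : IsOrGate S len neuron
    rests    : RestsWhenSilent neuron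
    outputs  : output neuron ≡ o

OrGateAt-initial : ∀ {S len NC N x} → InitialCircuit NC → N ∈ ln NC → ident N ≡ x →
  IsOrGate S len N → OrGateAt S len NC x (false ∷ [])
OrGateAt-initial {NC = NC} {N} initial N∈ln refl g = record
  { neuron   = N
  ; found    = findNeuron-unique (ids-distinct NC) N∈ln
  ; isOrGate = g
  ; rests    = λ _ → proj₂ (All.lookup initial N∈ln)
  ; outputs  = proj₁ (All.lookup initial N∈ln)
  }

OrGateAt-step : ∀ e {S len NC x o} → length (ln NC) + si NC ≡ len → OrGateAt S len NC x o →
  OrGateAt S len (step e NC) x (anyActive S (circuitInput (ln NC) e) len ∷ o)
OrGateAt-step e {S} {len} {NC} {x} refl g = record
  { neuron   = updateNeuron i len neuron
  ; found    = trans (findNeuron-map-updateNeuron i len (ln NC) x) (cong (Maybe.map (updateNeuron i len)) found)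
  ; isOrGate = IsOrGate-updateNeuron i len isOrGate
  ; rests    = proj₂ updated
  ; outputs  = trans (proj₁ updated) (cong (anyActive S i len ∷_) outputs)
  }
  where
  open OrGateAt g
  i : ℕ → Bool
  i = circuitInput (ln NC) e
  updated : output (updateNeuron i len neuron) ≡ anyActive S i len ∷ output neuron
          × RestsWhenSilent (updateNeuron i len neuron)
  updated = updateNeuron-IsOrGate i len isOrGate rests

outputNC-OrGateAt : ∀ NC inp N {S len x o} → ident N ≡ x → OrGateAt S len (process NC inp) x o →
  outputNC NC N inp ≡ just o
outputNC-OrGateAt NC inp N refl g rewrite OrGateAt.found g = cong just (OrGateAt.outputs g)

loopInputs₀ : ℕ → Bool
loopInputs₀ 1 = true
loopInputs₀ 2 = true
loopInputs₀ _ = false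

loopInputs₁ : ℕ → Bool
loopInputs₁ 0 = true
loopInputs₁ _ = false

w-self-≡ : ∀ N {x} → ident N ≡ x → w N x ≡ 0ℚ
w-self-≡ N refl = w-self N

IsOrGate-loop₀ : ∀ {N} → ident N ≡ 0 → τ N ≤ w N 1 → τ N ≤ w N 2 → IsOrGate loopInputs₀ 3 N
IsOrGate-loop₀ {N} id≡0 τ≤w₁ τ≤w₂ = record { excitatory = excitatory ; mute = mute }
  where
  excitatory : ∀ {k} → k < 3 → loopInputs₀ k ≡ true → τ N ≤ w N k
  excitatory {1} _ _ = τ≤w₁
  excitatory {2} _ _ = τ≤w₂
  mute : ∀ {k} → k < 3 → loopInputs₀ k ≡ false → w N k ≡ 0ℚ
  mute {0} _ _ = w-self-≡ N id≡0
  mute {suc (suc (suc _))} (s≤s (s≤s (s≤s ()))) _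

IsOrGate-loop₁ : ∀ {N} → ident N ≡ 1 → τ N ≤ w N 0 → w N 2 ≡ 0ℚ → IsOrGate loopInputs₁ 3 N
IsOrGate-loop₁ {N} id≡1 τ≤w₀ w₂≡0 = record { excitatory = excitatory ; mute = mute }
  where
  excitatory : ∀ {k} → k < 3 → loopInputs₁ k ≡ true → τ N ≤ w N k
  excitatory {0} _ _ = τ≤w₀
  mute : ∀ {k} → k < 3 → loopInputs₁ k ≡ false → w N k ≡ 0ℚ
  mute {1} _ _ = w-self-≡ N id≡1
  mute {2} _ _ = w₂≡0
  mute {suc (suc (suc _))} (s≤s (s≤s (s≤s ()))) _

loopStep : Bool → List Bool × List Bool → List Bool × List Bool
loopStep b (o₀ , o₁) = (headB o₁ ∨ b) ∷ o₀ , headB o₀ ∷ o₁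

loopOutputs : List Bool → List Bool × List Bool
loopOutputs = foldr loopStep (false ∷ [] , false ∷ [])

record LoopState (NC : Circuit) (o : List Bool × List Bool) : Set where
  field
    one-source  : si NC ≡ 1
    two-neurons : length (ln NC) ≡ 2
    gate₀       : OrGateAt loopInputs₀ 3 NC 0 (proj₁ o)
    gate₁       : OrGateAt loopInputs₁ 3 NC 1 (proj₂ o)

LoopState-step : ∀ b {NC o} → LoopState NC o → LoopState (step (fromBool b) NC) (loopStep b o)
LoopState-step b {NC} {o₀ , o₁} s = record
  { one-source  = one-source
  ; two-neurons = trans (length-map _ (ln NC)) two-neurons
  ; gate₀ = subst (OrGateAt loopInputs₀ 3 _ 0) (cong (_∷ o₀) (cong₂ _∨_ (input gate₁ (s≤s (s≤s z≤n))) source))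
                  (OrGateAt-step (fromBool b) environment gate₀)
  ; gate₁ = subst (OrGateAt loopInputs₁ 3 _ 1) (cong (_∷ o₁) (input gate₀ (s≤s z≤n)))
                  (OrGateAt-step (fromBool b) environment gate₁)
  }
  where
  open LoopState s
  i : ℕ → Bool
  i = circuitInput (ln NC) (fromBool b)
  environment : length (ln NC) + si NC ≡ 3
  environment = cong₂ _+_ two-neurons one-source
  input : ∀ {S x o} → OrGateAt S 3 NC x o → x < 2 → i x ≡ headB o
  input g x<2 = trans (circuitInput-neuron (ln NC) (fromBool b) (OrGateAt.found g)
                                           (subst (_ <_) (sym two-neurons) x<2))
                      (cong headB (OrGateAt.outputs g))
  source : i 2 ≡ b
  source = circuitInput-source (ln NC) (fromBool b) (subst (ℕ._≤ 2) (sym two-neurons) (s≤s (s≤s z≤n)))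

LoopState-process : ∀ {NC} → LoopState NC (loopOutputs []) → ∀ bs →
  LoopState (process NC (map fromBool bs)) (loopOutputs bs)
LoopState-process s []       = s
LoopState-process s (b ∷ bs) = LoopState-step b (LoopState-process s bs)

-- The positivity of the loop weights required by PositiveLoop is implied by the threshold hypotheses.
LoopState-initial : ∀ NC {N₀ N₁} → InitialCircuit NC → PositiveLoop NC →
  N₀ ∈ ln NC → ident N₀ ≡ 0 → N₁ ∈ ln NC → ident N₁ ≡ 1 →
  τ N₀ ≤ w N₀ 2 → τ N₀ ≤ w N₀ 1 → τ N₁ ≤ w N₁ 0 → LoopState NC (loopOutputs [])
LoopState-initial NC initial (one , two , _ , loop₁) N₀∈ln id₀ N₁∈ln id₁ τ₀≤w₂ τ₀≤w₁ τ₁≤w₀ = record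
  { one-source  = one
  ; two-neurons = two
  ; gate₀ = OrGateAt-initial initial N₀∈ln id₀ (IsOrGate-loop₀ id₀ τ₀≤w₁ τ₀≤w₂)
  ; gate₁ = OrGateAt-initial initial N₁∈ln id₁ (IsOrGate-loop₁ id₁ τ₁≤w₀ (proj₂ (loop₁ _ N₁∈ln id₁)))
  }

alternating : ℕ → List Bool
alternating = repeatPattern (true ∷ false ∷ [])

-- (k + 2) % 2 and k % 2 are the same term and fromℕ< ignores its proof, so this holds by computation.
headB-alternating-++ : ∀ n R → headB (alternating n ++ false ∷ R) ≡ headB (alternating (suc (suc n)))
headB-alternating-++ zero    R = refl
headB-alternating-++ (suc n) R = refl

loopOutputs-silent : ∀ {bs} → All (_≡ false) bs →
  loopOutputs bs ≡ (replicate (suc (length bs)) false , replicate (suc (length bs)) false)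
loopOutputs-silent []              = refl
loopOutputs-silent (refl ∷ silent) rewrite loopOutputs-silent silent = refl

loopOutputs-alternate : ∀ {xs} Z → All (_≡ false) xs →
  foldr loopStep (true ∷ Z , false ∷ Z) xs
    ≡ (alternating (suc (length xs)) ++ Z , alternating (length xs) ++ false ∷ Z)
loopOutputs-alternate Z [] = refl
loopOutputs-alternate {_ ∷ xs} Z (refl ∷ silent) rewrite loopOutputs-alternate Z silent =
  cong₂ _,_ (cong (_∷ alternating (suc (length xs)) ++ Z)
                  (trans (∨-identityʳ _) (headB-alternating-++ (length xs) Z)))
            refl

loopOutputs-pulse : ∀ {xs ys} → All (_≡ false) xs → All (_≡ false) ys →
  loopOutputs (xs ++ true ∷ ys) ≡
    (alternating (length xs + 1) ++ replicate (length ys + 1) false , alternating (length xs) ++ replicate (length ys + 2) false)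
loopOutputs-pulse {xs} {ys} silentˣ silentʸ
  rewrite foldr-++ loopStep (false ∷ [] , false ∷ []) xs (true ∷ ys) | loopOutputs-silent silentʸ
        | +-comm (length xs) 1 | +-comm (length ys) 1 | +-comm (length ys) 2 =
  loopOutputs-alternate (replicate (suc (length ys)) false) silentˣ

proposition6p5 : (NC : Circuit) → InitialCircuit NC → PositiveLoop NC →
    (N₀ N₁ : Neuron) → N₀ ∈ ln NC → ident N₀ ≡ 0 → N₁ ∈ ln NC → ident N₁ ≡ 1 →
    τ N₀ ≤ w N₀ 2 → τ N₀ ≤ w N₀ 1 → τ N₁ ≤ w N₁ 0 →
    (inp₁ inp₂ : List Bool) → All (_≡ false) inp₁ → All (_≡ false) inp₂ →
    (outputNC NC N₀ (map fromBool (inp₁ ++ (true ∷ []) ++ inp₂))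
       ≡ just (repeatPattern (true ∷ false ∷ []) (length inp₁ + 1) ++ replicate (length inp₂ + 1) false))
    × (outputNC NC N₁ (map fromBool (inp₁ ++ (true ∷ []) ++ inp₂))
       ≡ just (repeatPattern (true ∷ false ∷ []) (length inp₁) ++ replicate (length inp₂ + 2) false))
proposition6p5 NC initial loop N₀ N₁ N₀∈ln id₀ N₁∈ln id₁ τ₀≤w₂ τ₀≤w₁ τ₁≤w₀ inp₁ inp₂ silent₁ silent₂ =
  trans (outputNC-OrGateAt NC inputs N₀ id₀ gate₀) (cong (just ∘ proj₁) (loopOutputs-pulse silent₁ silent₂)) ,
  trans (outputNC-OrGateAt NC inputs N₁ id₁ gate₁) (cong (just ∘ proj₂) (loopOutputs-pulse silent₁ silent₂))
  where
  inputs : List (ℕ → Bool)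
  inputs = map fromBool (inp₁ ++ true ∷ inp₂)
  open LoopState (LoopState-process (LoopState-initial NC initial loop N₀∈ln id₀ N₁∈ln id₁ τ₀≤w₂ τ₀≤w₁ τ₁≤w₀)
                                    (inp₁ ++ true ∷ inp₂))
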